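{- Let $m\geq 3$ and $l\geq 3$. Then the graph $\mathrm{Cay}(\mathbb{Z}_m\times\mathbb{Z}_{2^l},\ \{\pm1\}\times\{2^{l-1}\})\cup mK_{2^l}$ can be decomposed into $2^{l-1}$ $C_{2^l}$-factors and a $1$-factor.
   Context: For a finite additive group $\Gamma$ and a subset $S\subseteq\Gamma\setminus\{0\}$ closed under negatives, the Cayley graph $\mathrm{Cay}(\Gamma,S)$ has vertex set $\Gamma$ and an edge between $a$ and $b$ whenever $a-b\in S$. Here $\{\pm1\}\times T$ denotes the set of pairs $(\epsilon,t)$ with $\epsilon\in\{1,-1\}\subseteq\mathbb{Z}_m$ and $t\in T$. $mK_n$ denotes the graph with vertex set $\mathbb{Z}_m\times\mathbb{Z}_n$ and edges $\{(j,a),(j,b)\}$ for all $j\in\mathbb{Z}_m$ and all distinct $a,b\in\mathbb{Z}_n$ (i.e. $m$ disjoint copies of $K_n$). The union of two graphs on the same vertex set is the graph whose edge set is the union of their edge sets. A $C_k$-factor is a spanning subgraph each of whose components is a $k$-cycle; a $1$-factor is a perfect matching; decomposing a graph into factors means partitioning its edge set into the edge sets of these factors. -}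

module Defs where

open import Data.Nat using (ℕ; zero; suc; _+_; _*_; _∸_; _^_; _≤_)
open import Data.Fin using (Fin; toℕ)
open import Data.Product using (Σ; ∃; _×_; _,_; proj₁; proj₂)
open import Data.Sum using (_⊎_)
open import Data.Unit using (⊤)
open import Relation.Binary.PropositionalEquality using (_≡_; _≢_)

Graph : Set → Set₁
Graph V = V → V → Set

-- b ≡ a + h (mod n), for a b : Fin n (i.e. residues in [0,n)) and h < n.
AddMod : (n h : ℕ) → Fin n → Fin n → Set
AddMod n h a b = (toℕ b ≡ toℕ a + h) ⊎ (toℕ b + n ≡ toℕ a + h)

Vtx : ℕ → ℕ → Set
Vtx m n = Fin m × Fin n

-- Cay(Z_m × Z_n, {±1} × {h}) : u ~ v iff u - v ∈ {±1} × {h},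
-- i.e. u = v + (ε , h) for some ε ∈ {1, -1}.
CayAdj : (m n h : ℕ) → Graph (Vtx m n)
CayAdj m n h u v =
  (AddMod m 1 (proj₁ v) (proj₁ u) ⊎ AddMod m 1 (proj₁ u) (proj₁ v))
  × AddMod n h (proj₂ v) (proj₂ u)

mKnAdj : (m n : ℕ) → Graph (Vtx m n)
mKnAdj m n u v = (proj₁ u ≡ proj₁ v) × (proj₂ u ≢ proj₂ v)

_∪G_ : {V : Set} → Graph V → Graph V → Graph V
(E ∪G F) u v = E u v ⊎ F u v

G : (m l : ℕ) → Graph (Vtx m (2 ^ l))
G m l = CayAdj m (2 ^ l) (2 ^ (l ∸ 1)) ∪G mKnAdj m (2 ^ l)

-- A C_k-factor on V: a family of r vertex-disjoint k-cycles covering every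
-- vertex exactly once (cyc c is the cyclic sequence of the c-th cycle).
record CkFactor (V : Set) (k : ℕ) : Set where
  field
    r    : ℕ
    cyc  : Fin r → Fin k → V
    inj  : ∀ c i c' i' → cyc c i ≡ cyc c' i' → (c ≡ c') × (i ≡ i')
    surj : ∀ v → Σ (Fin r) λ c → Σ (Fin k) λ i → cyc c i ≡ v

CkEdge : {V : Set} {k : ℕ} → CkFactor V k → Graph V
CkEdge {V} {k} F u v =
  Σ (Fin r) λ c → Σ (Fin k) λ i → Σ (Fin k) λ j →
    AddMod k 1 i j × ((cyc c i ≡ u × cyc c j ≡ v) ⊎ (cyc c i ≡ v × cyc c j ≡ u))
  where open CkFactor F

-- A 1-factor (perfect matching): a fixed-point-free involution.
record OneFactor (V : Set) : Set where
  field
    μ      : V → V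
    invol  : ∀ v → μ (μ v) ≡ v
    nofix  : ∀ v → μ v ≢ v

OneEdge : {V : Set} → OneFactor V → Graph V
OneEdge F u v = v ≡ OneFactor.μ F u

PartEdge : {V : Set} {t k : ℕ} → (Fin t → CkFactor V k) → OneFactor V →
           Fin t ⊎ ⊤ → Graph V
PartEdge fs M (Data.Sum.inj₁ i) = CkEdge (fs i)
PartEdge fs M (Data.Sum.inj₂ _) = OneEdge M

IsEdgePartition : {V : Set} {P : Set} → Graph V → (P → Graph V) → Set
IsEdgePartition {V} {P} E part =
    (∀ u v → E u v → Σ P λ p → part p u v)
  × (∀ p u v → part p u v → E u v)
  × (∀ p q u v → part p u v → part q u v → p ≡ q)

DecomposesInto : {V : Set} → Graph V → (t k : ℕ) → Set
DecomposesInto {V} E t k =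
  Σ (Fin t → CkFactor V k) λ fs → Σ (OneFactor V) λ M →
    IsEdgePartition E (PartEdge fs M)

module Submission where

-- Write n = 2^l = 4q and h = n/2.  The zigzag 0, 1, −1, 2, −2, …, h is a Hamiltonian path of
-- K_n on Z_n, and its translates by t = 0, …, h − 1 partition the edges of K_n other than the
-- diameters {x, x + h}.  The t-th translate runs from t to t + h and its middle edge is the
-- diameter {t + q, t − q}.  For t < q, closing it by the diameter {t, t + h} gives a Hamiltonian
-- cycle in every layer {j} × Z_n, and these cycles use every diameter exactly once.  For q ≤ t,
-- the cycle starting in layer j crosses to layer j + 1 through the Cayley edge
-- {(j, t + q), (j + 1, t − q)} in place of the middle edge and returns through the Cayley edge
-- {(j + 1, t + h), (j, t)}.  The remaining Cayley edges {(j, x), (j + 1, x + h)}, those with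
-- x ∉ [q, h + q), form the 1-factor.  Only n ≡ 0 (mod 4) and m ≥ 3 are needed.

open import Defs
open import Data.Nat using (ℕ; _≤_; _^_; _∸_)
open import Data.Nat.Base using (zero; suc; pred; _+_; _<_; z≤n; s≤s; NonZero; ⌊_/2⌋; parity)
open import Data.Nat.Properties
open import Data.Nat.DivMod using (_%_; m%n<n; %-distribˡ-+; [m+n]%n≡m%n; m%n%n≡m%n; m<n⇒m%n≡m)
open import Data.Parity.Base using (Parity; 0ℙ; 1ℙ)
open import Data.Fin.Base using (Fin; zero; toℕ; fromℕ; fromℕ<)
open import Data.Fin.Properties using (toℕ-injective; toℕ-fromℕ; toℕ-fromℕ<; toℕ<n) renaming (_≟_ to _≟ᶠ_)
open import Data.Bool.Base using (Bool; true; false; if_then_else_; _∧_)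
open import Data.Bool.Properties using (∧-zeroʳ)
open import Data.Product using (Σ; ∃; _×_; _,_; proj₁; proj₂)
open import Data.Sum using (_⊎_; inj₁; inj₂; swap; map₁; map₂)
open import Data.Sum.Properties using (inj₁-injective)
open import Data.Unit using (⊤; tt)
open import Data.Empty using (⊥; ⊥-elim)
open import Algebra.Properties.CommutativeSemigroup +-commutativeSemigroup using (interchange)
open import Relation.Nullary using (¬_; Dec; yes; no; does; contradiction)
open import Relation.Nullary.Decidable using (dec-true; dec-false; _⊎-dec_)
open import Relation.Binary.Bundles using (Setoid)
open import Relation.Binary.Structures using (IsEquivalence)
open import Relation.Binary.PropositionalEquality
  using (_≡_; _≢_; refl; sym; trans; cong; cong₂; subst; subst₂; module ≡-Reasoning)
import Relation.Binary.Reasoning.Setoid as SetoidReasoning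

module Modular (k : ℕ) .{{_ : NonZero k}} where

  infix 4 _≋_
  record _≋_ (a b : ℕ) : Set where
    constructor mk≋
    field %-eq : a % k ≡ b % k
  open _≋_

  ≋-isEquivalence : IsEquivalence _≋_
  ≋-isEquivalence = record
    { refl  = mk≋ refl
    ; sym   = λ e → mk≋ (sym (%-eq e))
    ; trans = λ e f → mk≋ (trans (%-eq e) (%-eq f))
    }

  ≋-setoid : Setoid _ _
  ≋-setoid = record { isEquivalence = ≋-isEquivalence }

  open IsEquivalence ≋-isEquivalence public
    using () renaming (refl to ≋-refl; sym to ≋-sym; trans to ≋-trans; reflexive to ≡⇒≋)
  module ≋-Reasoning = SetoidReasoning ≋-setoid

  +-cong : ∀ {a b c d} → a ≋ b → c ≋ d → a + c ≋ b + d
  +-cong {a} {b} {c} {d} (mk≋ a≋b) (mk≋ c≋d) = mk≋ (begin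
    (a + c) % k               ≡⟨ %-distribˡ-+ a c k ⟩
    (a % k + c % k) % k       ≡⟨ cong₂ (λ x y → (x + y) % k) a≋b c≋d ⟩
    (b % k + d % k) % k       ≡⟨ %-distribˡ-+ b d k ⟨
    (b + d) % k               ∎)
    where open ≡-Reasoning

  +-congˡ : ∀ {a b} c → a ≋ b → c + a ≋ c + b
  +-congˡ c = +-cong ≋-refl

  +-congʳ : ∀ {a b} c → a ≋ b → a + c ≋ b + c
  +-congʳ c a≋b = +-cong a≋b ≋-refl

  m+k≋m : ∀ a → a + k ≋ a
  m+k≋m a = mk≋ ([m+n]%n≡m%n a k)

  m%k≋m : ∀ a → a % k ≋ a
  m%k≋m a = mk≋ (m%n%n≡m%n a k)

  +-cancelʳ : ∀ a b c → a + c ≋ b + c → a ≋ b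
  +-cancelʳ a b c e = begin
    a                       ≈⟨ m+k≋m a ⟨
    a + k                   ≡⟨ cong (a +_) c%k+c′≡k ⟨
    a + (c % k + c′)        ≈⟨ +-congˡ a (+-congʳ c′ (m%k≋m c)) ⟩
    a + (c + c′)            ≡⟨ +-assoc a c c′ ⟨
    a + c + c′              ≈⟨ +-congʳ c′ e ⟩
    b + c + c′              ≡⟨ +-assoc b c c′ ⟩
    b + (c + c′)            ≈⟨ +-congˡ b (+-congʳ c′ (m%k≋m c)) ⟨
    b + (c % k + c′)        ≡⟨ cong (b +_) c%k+c′≡k ⟩
    b + k                   ≈⟨ m+k≋m b ⟩
    b                       ∎
    where
    open ≋-Reasoning
    c′ = k ∸ c % k
    c%k+c′≡k : c % k + c′ ≡ k
    c%k+c′≡k = m+[n∸m]≡n (<⇒≤ (m%n<n c k))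

  +-cancelˡ : ∀ a b c → c + a ≋ c + b → a ≋ b
  +-cancelˡ a b c e = +-cancelʳ a b c (≋-trans (≡⇒≋ (+-comm a c)) (≋-trans e (≡⇒≋ (+-comm c b))))

  ≋⇒≡ : ∀ {a b} → a < k → b < k → a ≋ b → a ≡ b
  ≋⇒≡ {a} {b} a<k b<k (mk≋ e) = trans (sym (m<n⇒m%n≡m a<k)) (trans e (m<n⇒m%n≡m b<k))

  ≋⇒≡-positive : ∀ {a b} → 1 ≤ a → a ≤ k → 1 ≤ b → b ≤ k → a ≋ b → a ≡ b
  ≋⇒≡-positive {suc a} {suc b} _ a<k _ b<k e =
    cong suc (≋⇒≡ a<k b<k (+-cancelʳ a b 1 (≋-trans (≡⇒≋ (+-comm a 1)) (≋-trans e (≡⇒≋ (+-comm 1 b))))))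

  ≋-above : ∀ {a e} → e < k → e < a → a ≤ k + k → a ≋ e → a ≡ k + e ⊎ a ≡ k + k
  ≋-above {a} {e} e<k e<a a≤2k a≋e with a <? k | m≤n⇒m<n∨m≡n a≤2k
  ... | yes a<k | _        = contradiction (≋⇒≡ a<k e<k a≋e) (>⇒≢ e<a)
  ... | no _    | inj₂ a≡2k = inj₂ a≡2k
  ... | no a≮k  | inj₁ a<2k = inj₁ (begin
    a              ≡⟨ m∸n+n≡m k≤a ⟨
    a ∸ k + k      ≡⟨ cong (_+ k) (≋⇒≡ a∸k<k e<k (≋-trans (≋-sym (m+k≋m (a ∸ k))) (≋-trans (≡⇒≋ (m∸n+n≡m k≤a)) a≋e))) ⟩
    e + k          ≡⟨ +-comm e k ⟩
    k + e          ∎)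
    where
    open ≡-Reasoning
    k≤a : k ≤ a
    k≤a = ≮⇒≥ a≮k
    a∸k<k : a ∸ k < k
    a∸k<k = +-cancelʳ-< k (a ∸ k) k (subst (_< k + k) (sym (m∸n+n≡m k≤a)) a<2k)

  positive-offset : ∀ {t} → t < k → ∀ a → a < k → ∃ λ o → 1 ≤ o × o ≤ k × a ≋ t + o
  positive-offset {t} t<k a a<k with t <? a
  ... | yes t<a = a ∸ t , m<n⇒0<n∸m t<a , ≤-trans (m∸n≤m a t) (<⇒≤ a<k) , ≡⇒≋ (sym (m+[n∸m]≡n (<⇒≤ t<a)))
  ... | no t≮a = a + k ∸ t , m<n⇒0<n∸m (<-≤-trans t<k (m≤n+m k a)) , o≤k ,
                 ≋-trans (≋-sym (m+k≋m a)) (≡⇒≋ (sym (m+[n∸m]≡n (≤-trans (<⇒≤ t<k) (m≤n+m k a)))))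
    where
    o≤k : a + k ∸ t ≤ k
    o≤k = ≤-trans (∸-monoʳ-≤ (a + k) (≮⇒≥ t≮a)) (≤-reflexive (m+n∸m≡n a k))

  [_] : ℕ → Fin k
  [ a ] = fromℕ< (m%n<n a k)

  toℕ-[] : ∀ a → toℕ [ a ] ≡ a % k
  toℕ-[] a = toℕ-fromℕ< (m%n<n a k)

  toℕ-[]-< : ∀ {a} → a < k → toℕ [ a ] ≡ a
  toℕ-[]-< {a} a<k = trans (toℕ-[] a) (m<n⇒m%n≡m a<k)

  toℕ-[]≋ : ∀ a → toℕ [ a ] ≋ a
  toℕ-[]≋ a = ≋-trans (≡⇒≋ (toℕ-[] a)) (m%k≋m a)

  []-cong : ∀ {a b} → a ≋ b → [ a ] ≡ [ b ]
  []-cong {a} {b} (mk≋ e) = toℕ-injective (trans (toℕ-[] a) (trans e (sym (toℕ-[] b))))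

  []-injective : ∀ {a b} → [ a ] ≡ [ b ] → a ≋ b
  []-injective {a} {b} e = ≋-trans (≋-sym (toℕ-[]≋ a)) (≋-trans (≡⇒≋ (cong toℕ e)) (toℕ-[]≋ b))

  toℕ-≋-injective : ∀ {x y : Fin k} → toℕ x ≋ toℕ y → x ≡ y
  toℕ-≋-injective {x} {y} e = toℕ-injective (≋⇒≡ (toℕ<n x) (toℕ<n y) e)

  ≋⇒≡[] : ∀ {x : Fin k} {a} → toℕ x ≋ a → x ≡ [ a ]
  ≋⇒≡[] {x} {a} e = toℕ-≋-injective (≋-trans e (≋-sym (toℕ-[]≋ a)))

  []-toℕ : ∀ x → [ toℕ x ] ≡ x
  []-toℕ x = sym (≋⇒≡[] ≋-refl)

  infixl 6 _⊕_
  _⊕_ : Fin k → ℕ → Fin k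
  x ⊕ d = [ toℕ x + d ]

  toℕ-⊕≋ : ∀ x d → toℕ (x ⊕ d) ≋ toℕ x + d
  toℕ-⊕≋ x d = toℕ-[]≋ (toℕ x + d)

  []-⊕ : ∀ t d (x : Fin k) → t + d ≡ toℕ x → [ t ] ⊕ d ≡ x
  []-⊕ t d x t+d≡x = sym (≋⇒≡[] (≋-trans (≡⇒≋ (sym t+d≡x)) (+-congʳ d (≋-sym (toℕ-[]≋ t)))))

  ⊕-assoc : ∀ x d e → x ⊕ d ⊕ e ≡ x ⊕ (d + e)
  ⊕-assoc x d e = []-cong (≋-trans (+-congʳ e (toℕ-⊕≋ x d)) (≡⇒≋ (+-assoc (toℕ x) d e)))

  ⊕-k : ∀ x → x ⊕ k ≡ x
  ⊕-k x = toℕ-≋-injective (≋-trans (toℕ-⊕≋ x k) (m+k≋m (toℕ x)))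

  ⊕-≢ : ∀ {d} → 0 < d → d < k → ∀ x → x ⊕ d ≢ x
  ⊕-≢ {d} 0<d d<k x x⊕d≡x = <⇒≢ 0<d (sym (≋⇒≡ d<k (≤-trans (s≤s z≤n) d<k) d≋0))
    where
    d≋0 : d ≋ 0
    d≋0 = +-cancelˡ d 0 (toℕ x)
      (≋-trans (≋-sym (toℕ-⊕≋ x d)) (≡⇒≋ (trans (cong toℕ x⊕d≡x) (sym (+-identityʳ (toℕ x))))))

  toℕ-⊕-< : ∀ x {d} → toℕ x + d < k → toℕ (x ⊕ d) ≡ toℕ x + d
  toℕ-⊕-< x = toℕ-[]-<

  toℕ-⊕-≥ : ∀ x {d} → k ≤ toℕ x + d → d ≤ k → toℕ (x ⊕ d) + k ≡ toℕ x + d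
  toℕ-⊕-≥ x {d} k≤a d≤k = begin
    toℕ (x ⊕ d) + k          ≡⟨ cong (_+ k) (toℕ-[] a) ⟩
    a % k + k                ≡⟨ cong (λ z → z % k + k) (m∸n+n≡m k≤a) ⟨
    (a ∸ k + k) % k + k      ≡⟨ cong (_+ k) (trans ([m+n]%n≡m%n (a ∸ k) k) (m<n⇒m%n≡m a∸k<k)) ⟩
    a ∸ k + k                ≡⟨ m∸n+n≡m k≤a ⟩
    a                        ∎
    where
    open ≡-Reasoning
    a = toℕ x + d
    a∸k<k : a ∸ k < k
    a∸k<k = +-cancelʳ-< k (a ∸ k) k (subst (_< k + k) (sym (m∸n+n≡m k≤a)) (+-mono-<-≤ (toℕ<n x) d≤k))

  AddMod-⊕ : ∀ {d} → d ≤ k → ∀ x → AddMod k d x (x ⊕ d)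
  AddMod-⊕ {d} d≤k x with toℕ x + d <? k
  ... | yes lt = inj₁ (toℕ-⊕-< x lt)
  ... | no ¬lt = inj₂ (toℕ-⊕-≥ x (≮⇒≥ ¬lt) d≤k)

  AddMod⇒≡⊕ : ∀ {d x y} → AddMod k d x y → y ≡ x ⊕ d
  AddMod⇒≡⊕ (inj₁ e) = ≋⇒≡[] (≡⇒≋ e)
  AddMod⇒≡⊕ {y = y} (inj₂ e) = ≋⇒≡[] (≋-trans (≋-sym (m+k≋m (toℕ y))) (≡⇒≋ e))

parity-even : ∀ s → parity (s + s) ≡ 0ℙ
parity-even zero = refl
parity-even (suc s) rewrite +-suc s s = parity-even s

parity-odd : ∀ s → parity (suc (s + s)) ≡ 1ℙ
parity-odd zero = refl
parity-odd (suc s) rewrite +-suc s s = parity-odd s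

1+m+m≢n+n : ∀ m n → suc (m + m) ≢ n + n
1+m+m≢n+n m n e with trans (sym (parity-odd m)) (trans (cong parity e) (parity-even n))
... | ()

even⊎odd : ∀ p → (∃ λ s → p ≡ s + s) ⊎ (∃ λ s → p ≡ suc (s + s))
even⊎odd zero = inj₁ (0 , refl)
even⊎odd (suc p) with even⊎odd p
... | inj₁ (s , p≡s+s) = inj₂ (s , cong suc p≡s+s)
... | inj₂ (s , p≡1+s+s) = inj₁ (suc s , trans (cong suc p≡1+s+s) (cong suc (sym (+-suc s s))))

m+m<n+n⇒m<n : ∀ {m n} → m + m < n + n → m < n
m+m<n+n⇒m<n {m} {n} lt with m <? n
... | yes m<n = m<n
... | no m≮n = contradiction (+-mono-≤ (≮⇒≥ m≮n) (≮⇒≥ m≮n)) (<⇒≱ lt)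

1+m+m<n+n⇒m<n : ∀ {m n} → suc (m + m) < n + n → m < n
1+m+m<n+n⇒m<n lt = m+m<n+n⇒m<n (<-trans (n<1+n _) lt)

⌊m+m+e/2⌋≡m : ∀ m {e} → e ≤ 1 → ⌊ m + m + e /2⌋ ≡ m
⌊m+m+e/2⌋≡m m z≤n       = trans (cong ⌊_/2⌋ (+-identityʳ (m + m))) (sym (n≡⌊n+n/2⌋ m))
⌊m+m+e/2⌋≡m m (s≤s z≤n) = trans (cong ⌊_/2⌋ (+-comm (m + m) 1)) (sym (n≡⌈n+n/2⌉ m))

m+n≡o+o⇒m≡o : ∀ {m n o} → m ≤ o → n ≤ o → m + n ≡ o + o → m ≡ o
m+n≡o+o⇒m≡o m≤o n≤o m+n≡2o with m≤n⇒m<n∨m≡n m≤o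
... | inj₁ m<o = contradiction m+n≡2o (<⇒≢ (+-mono-<-≤ m<o n≤o))
... | inj₂ m≡o = m≡o

addMod? : ∀ k d (x y : Fin k) → Dec (AddMod k d x y)
addMod? k d x y = toℕ y ≟ toℕ x + d ⊎-dec toℕ y + k ≟ toℕ x + d

module Zigzag (h : ℕ) where

  n : ℕ
  n = h + h

  zig : Parity → ℕ → ℕ
  zig 0ℙ s = n ∸ s
  zig 1ℙ s = suc s

  -- ζ p is the p-th vertex of the zigzag, represented in [1, n] (with n standing for 0).
  ζ : ℕ → ℕ
  ζ p = zig (parity p) ⌊ p /2⌋

  ζ-even : ∀ s → ζ (s + s) ≡ n ∸ s
  ζ-even s = cong₂ zig (parity-even s) (sym (n≡⌊n+n/2⌋ s))

  ζ-odd : ∀ s → ζ (suc (s + s)) ≡ suc s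
  ζ-odd s = cong₂ zig (parity-odd s) (sym (n≡⌈n+n/2⌉ s))

  h≤n : h ≤ n
  h≤n = m≤m+n h h

  s+s<n⇒s<h : ∀ s → s + s < n → s < h
  s+s<n⇒s<h s = m+m<n+n⇒m<n {s}

  1+s+s<n⇒s<h : ∀ s → suc (s + s) < n → s < h
  1+s+s<n⇒s<h s = 1+m+m<n+n⇒m<n {s}

  h<n∸s : ∀ {s} → s < h → h < n ∸ s
  h<n∸s {s} s<h = begin-strict
    h              ≡⟨ +-identityʳ h ⟨
    h + 0          <⟨ +-monoʳ-< h (m<n⇒0<n∸m s<h) ⟩
    h + (h ∸ s)    ≡⟨ +-∸-assoc h (<⇒≤ s<h) ⟨
    n ∸ s          ∎
    where open ≤-Reasoning

  ζ-range : ∀ {p} → p < n → 1 ≤ ζ p × ζ p ≤ n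
  ζ-range {p} p<n with even⊎odd p
  ... | inj₁ (s , refl) rewrite ζ-even s = ≤-trans (s≤s z≤n) (h<n∸s (s+s<n⇒s<h s p<n)) , m∸n≤m n s
  ... | inj₂ (s , refl) rewrite ζ-odd s = s≤s z≤n , ≤-trans (1+s+s<n⇒s<h s p<n) h≤n

  ζ-injective : ∀ {p p′} → p < n → p′ < n → ζ p ≡ ζ p′ → p ≡ p′
  ζ-injective {p} {p′} p<n p′<n e with even⊎odd p | even⊎odd p′
  ... | inj₁ (s , refl) | inj₁ (s′ , refl) rewrite ζ-even s | ζ-even s′ =
    cong (λ z → z + z) (∸-cancelˡ-≡ (s≤n (s+s<n⇒s<h s p<n)) (s≤n (s+s<n⇒s<h s′ p′<n)) e)
    where
    s≤n : ∀ {s} → s < h → s ≤ n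
    s≤n s<h = ≤-trans (<⇒≤ s<h) h≤n
  ... | inj₂ (s , refl) | inj₂ (s′ , refl) rewrite ζ-odd s | ζ-odd s′ = cong (λ z → suc (z + z)) (suc-injective e)
  ... | inj₁ (s , refl) | inj₂ (s′ , refl) rewrite ζ-even s | ζ-odd s′ =
    contradiction (subst (_≤ h) (sym e) (1+s+s<n⇒s<h s′ p′<n)) (<⇒≱ (h<n∸s (s+s<n⇒s<h s p<n)))
  ... | inj₂ (s , refl) | inj₁ (s′ , refl) rewrite ζ-odd s | ζ-even s′ =
    contradiction (subst (_≤ h) e (1+s+s<n⇒s<h s p<n)) (<⇒≱ (h<n∸s (s+s<n⇒s<h s′ p′<n)))

  ζ-surjective : ∀ {o} → 1 ≤ o → o ≤ n → ∃ λ p → p < n × ζ p ≡ o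
  ζ-surjective {suc o} _ o<n with suc o ≤? h
  ... | yes o<h = suc (o + o) , subst (_≤ n) (cong suc (+-suc o o)) (+-mono-≤ o<h o<h) , ζ-odd o
  ... | no o≮h = s + s , +-mono-< s<h s<h , trans (ζ-even s) (m∸[m∸n]≡n o<n)
    where
    s = n ∸ suc o
    s<h : s < h
    s<h = subst (s <_) (m+n∸m≡n h h) (∸-monoʳ-< (≰⇒> o≮h) o<n)

  ζ-consecutive : ∀ {p} → suc p < n → ∃ λ e → e ≤ 1 × ζ p + ζ (suc p) ≡ n + e
  ζ-consecutive {p} lt with even⊎odd p
  ... | inj₁ (s , refl) rewrite ζ-even s | ζ-odd s = 1 , s≤s z≤n , (begin
    n ∸ s + suc s     ≡⟨ +-suc (n ∸ s) s ⟩
    suc (n ∸ s + s)   ≡⟨ cong suc (m∸n+n≡m (≤-trans (<⇒≤ (1+s+s<n⇒s<h s lt)) h≤n)) ⟩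
    suc n             ≡⟨ +-comm 1 n ⟩
    n + 1             ∎)
    where open ≡-Reasoning
  ... | inj₂ (s , refl) = 0 , z≤n , (begin
    ζ (suc (s + s)) + ζ (suc (suc (s + s)))   ≡⟨ cong₂ _+_ (ζ-odd s) (cong (λ z → ζ (suc z)) (sym (+-suc s s))) ⟩
    suc s + ζ (suc s + suc s)                 ≡⟨ cong (suc s +_) (ζ-even (suc s)) ⟩
    suc s + (n ∸ suc s)                       ≡⟨ m+[n∸m]≡n (≤-trans (1+s+s<n⇒s<h s (<-trans (n<1+n _) lt)) h≤n) ⟩
    n                                         ≡⟨ +-identityʳ n ⟨
    n + 0                                     ∎)
    where open ≡-Reasoning

  odd+even≡n+e⇒adjacent : ∀ {s s′ e} → s′ ≤ n → e ≤ 1 → suc s + (n ∸ s′) ≡ n + e → s′ ≡ suc s ⊎ s ≡ s′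
  odd+even≡n+e⇒adjacent {s} {s′} {e} s′≤n e≤1 sum≡ = cases e≤1 (+-cancelʳ-≡ n (suc s) (e + s′) (begin
    suc s + n                ≡⟨ cong (suc s +_) (m∸n+n≡m s′≤n) ⟨
    suc s + (n ∸ s′ + s′)    ≡⟨ +-assoc (suc s) (n ∸ s′) s′ ⟨
    suc s + (n ∸ s′) + s′    ≡⟨ cong (_+ s′) sum≡ ⟩
    n + e + s′               ≡⟨ cong (_+ s′) (+-comm n e) ⟩
    e + n + s′               ≡⟨ +-assoc e n s′ ⟩
    e + (n + s′)             ≡⟨ cong (e +_) (+-comm n s′) ⟩
    e + (s′ + n)             ≡⟨ +-assoc e s′ n ⟨
    e + s′ + n               ∎))
    where
    open ≡-Reasoning
    cases : e ≤ 1 → suc s ≡ e + s′ → s′ ≡ suc s ⊎ s ≡ s′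
    cases z≤n       1+s≡s′   = inj₁ (sym 1+s≡s′)
    cases (s≤s z≤n) 1+s≡1+s′ = inj₂ (suc-injective 1+s≡1+s′)

  ζ-sum⇒adjacent : ∀ {p p′ e} → p < n → p′ < n → p ≢ p′ → e ≤ 1 → ζ p + ζ p′ ≡ n + e →
                   p′ ≡ suc p ⊎ p ≡ suc p′
  ζ-sum⇒adjacent {p} {p′} {e} p<n p′<n p≢p′ e≤1 sum≡ with even⊎odd p | even⊎odd p′
  ... | inj₁ (s , refl) | inj₁ (s′ , refl) rewrite ζ-even s | ζ-even s′ =
    contradiction sum≡ (>⇒≢ (begin-strict
      n + e                ≤⟨ +-monoʳ-≤ n e≤1 ⟩
      n + 1                ≡⟨ +-comm n 1 ⟩
      suc n                <⟨ n<1+n (suc n) ⟩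
      suc (suc n)          ≡⟨ cong suc (+-suc h h) ⟨
      suc h + suc h        ≤⟨ +-mono-≤ (h<n∸s (s+s<n⇒s<h s p<n)) (h<n∸s (s+s<n⇒s<h s′ p′<n)) ⟩
      n ∸ s + (n ∸ s′)     ∎))
    where open ≤-Reasoning
  ... | inj₂ (s , refl) | inj₂ (s′ , refl) rewrite ζ-odd s | ζ-odd s′ =
    ⊥-elim (both-middle (m≤n⇒m<n∨m≡n (1+s+s<n⇒s<h s p<n)) (m≤n⇒m<n∨m≡n (1+s+s<n⇒s<h s′ p′<n)))
    where
    below : suc s + suc s′ < n → ⊥
    below lt = <⇒≢ (<-≤-trans lt (m≤m+n n e)) sum≡
    both-middle : suc s < h ⊎ suc s ≡ h → suc s′ < h ⊎ suc s′ ≡ h → ⊥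
    both-middle (inj₁ lt) _ = below (+-mono-<-≤ lt (1+s+s<n⇒s<h s′ p′<n))
    both-middle (inj₂ _) (inj₁ lt) = below (+-mono-≤-< (1+s+s<n⇒s<h s p<n) lt)
    both-middle (inj₂ 1+s≡h) (inj₂ 1+s′≡h) =
      contradiction (cong (λ z → suc (z + z)) (suc-injective (trans 1+s≡h (sym 1+s′≡h)))) p≢p′
  ... | inj₂ (s , refl) | inj₁ (s′ , refl) rewrite ζ-odd s | ζ-even s′
    with odd+even≡n+e⇒adjacent (≤-trans (<⇒≤ (s+s<n⇒s<h s′ p′<n)) h≤n) e≤1 sum≡
  ... | inj₁ refl = inj₁ (cong suc (+-suc s s))
  ... | inj₂ refl = inj₂ refl
  ζ-sum⇒adjacent {p} {p′} {e} p<n p′<n p≢p′ e≤1 sum≡ | inj₁ (s , refl) | inj₂ (s′ , refl)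
    rewrite ζ-even s | ζ-odd s′
    with odd+even≡n+e⇒adjacent (≤-trans (<⇒≤ (s+s<n⇒s<h s p<n)) h≤n) e≤1 (trans (+-comm (suc s′) (n ∸ s)) sum≡)
  ... | inj₁ refl = inj₂ (cong suc (+-suc s′ s′))
  ... | inj₂ refl = inj₁ refl

module Decomposition (m′ q′ : ℕ) where

  q h : ℕ
  q = suc q′
  h = q + q

  open Zigzag h public

  m : ℕ
  m = suc (suc (suc m′))

  V : Set
  V = Fin m × Fin n

  module Zₘ = Modular m
  module Zₙ = Modular n
  open Zₙ using (_≋_; [_])

  next prev : Fin m → Fin m
  next j = j Zₘ.⊕ 1
  prev j = j Zₘ.⊕ suc (suc m′)

  next-prev : ∀ j → next (prev j) ≡ j
  next-prev j = trans (Zₘ.⊕-assoc j (suc (suc m′)) 1) (trans (cong (j Zₘ.⊕_) (+-comm (suc (suc m′)) 1)) (Zₘ.⊕-k j))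

  prev-next : ∀ j → prev (next j) ≡ j
  prev-next j = trans (Zₘ.⊕-assoc j 1 (suc (suc m′))) (Zₘ.⊕-k j)

  next-injective : ∀ {a b} → next a ≡ next b → a ≡ b
  next-injective {a} {b} e = trans (sym (prev-next a)) (trans (cong prev e) (prev-next b))

  next≢ : ∀ j → next j ≢ j
  next≢ = Zₘ.⊕-≢ (s≤s z≤n) (s≤s (s≤s z≤n))

  AddMod-next : ∀ j → AddMod m 1 j (next j)
  AddMod-next = Zₘ.AddMod-⊕ (s≤s z≤n)

  AddMod⇒≡next : ∀ {a b} → AddMod m 1 a b → b ≡ next a
  AddMod⇒≡next {a} {b} = Zₘ.AddMod⇒≡⊕ {1} {a} {b}

  AddMod-asym : ∀ {a b} → AddMod m 1 a b → ¬ AddMod m 1 b a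
  AddMod-asym {a} {b} ab ba = Zₘ.⊕-≢ (s≤s z≤n) (s≤s (s≤s (s≤s z≤n))) a (sym (begin
    a              ≡⟨ AddMod⇒≡next ba ⟩
    next b         ≡⟨ cong next (AddMod⇒≡next ab) ⟩
    next (next a)  ≡⟨ Zₘ.⊕-assoc a 1 1 ⟩
    a Zₘ.⊕ 2       ∎))
    where open ≡-Reasoning

  flip : Fin n → Fin n
  flip x = x Zₙ.⊕ h

  flip-flip : ∀ x → flip (flip x) ≡ x
  flip-flip x = trans (Zₙ.⊕-assoc x h h) (Zₙ.⊕-k x)

  flip≢ : ∀ x → flip x ≢ x
  flip≢ = Zₙ.⊕-≢ (s≤s z≤n) (m<m+n h (s≤s z≤n))

  AddMod-flip : ∀ x → AddMod n h x (flip x)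
  AddMod-flip = Zₙ.AddMod-⊕ h≤n

  AddMod⇒≡flip : ∀ {x y} → AddMod n h x y → y ≡ flip x
  AddMod⇒≡flip {x} {y} = Zₙ.AddMod⇒≡⊕ {h} {x} {y}

  AddMod-h-sym : ∀ {x y} → AddMod n h x y → AddMod n h y x
  AddMod-h-sym {x} {y} xy = subst (AddMod n h y) (trans (cong flip (AddMod⇒≡flip xy)) (flip-flip x)) (AddMod-flip y)

  toℕ-flip-< : ∀ x → toℕ x < h → toℕ (flip x) ≡ toℕ x + h
  toℕ-flip-< x x<h = Zₙ.toℕ-⊕-< x (+-monoˡ-< h x<h)

  toℕ-flip-≥ : ∀ x → h ≤ toℕ x → toℕ (flip x) + h ≡ toℕ x
  toℕ-flip-≥ x h≤x = +-cancelʳ-≡ h (toℕ (flip x) + h) (toℕ x) (begin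
    toℕ (flip x) + h + h    ≡⟨ +-assoc (toℕ (flip x)) h h ⟩
    toℕ (flip x) + n        ≡⟨ Zₙ.toℕ-⊕-≥ x (+-monoˡ-≤ h h≤x) h≤n ⟩
    toℕ x + h               ∎)
    where open ≡-Reasoning

  -- The C_n-factors

  vertex : ℕ → ℕ → Fin n
  vertex t p = [ t + ζ p ]

  vertex-injective : ∀ t {p p′} → p < n → p′ < n → vertex t p ≡ vertex t p′ → p ≡ p′
  vertex-injective t {p} {p′} p<n p′<n e = ζ-injective p<n p′<n
    (Zₙ.≋⇒≡-positive (proj₁ (ζ-range p<n)) (proj₂ (ζ-range p<n)) (proj₁ (ζ-range p′<n)) (proj₂ (ζ-range p′<n))
      (Zₙ.+-cancelˡ (ζ p) (ζ p′) t (Zₙ.[]-injective e)))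

  vertex-surjective : ∀ {t} → t < n → (x : Fin n) → Σ (Fin n) λ p → vertex t (toℕ p) ≡ x
  vertex-surjective {t} t<n x with Zₙ.positive-offset t<n (toℕ x) (toℕ<n x)
  ... | o , 1≤o , o≤n , x≋t+o with ζ-surjective 1≤o o≤n
  ...   | p , p<n , ζp≡o =
    fromℕ< p<n , trans (cong (λ i → [ t + ζ i ]) (toℕ-fromℕ< p<n)) (sym (Zₙ.≋⇒≡[] (Zₙ.≋-trans x≋t+o (Zₙ.≡⇒≋ (cong (t +_) (sym ζp≡o))))))

  -- For q ≤ t the second half of the t-th path is lifted to the next layer.
  crosses : ℕ → ℕ → Bool
  crosses t p = does (q ≤? t) ∧ does (h ≤? p)

  layer : ℕ → Fin m → ℕ → Fin m
  layer t c p = if crosses t p then next c else c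

  layer-<q : ∀ {t} c p → t < q → layer t c p ≡ c
  layer-<q {t} c p t<q rewrite dec-false (q ≤? t) (<⇒≱ t<q) = refl

  layer-<h : ∀ t c {p} → p < h → layer t c p ≡ c
  layer-<h t c {p} p<h rewrite dec-false (h ≤? p) (<⇒≱ p<h) | ∧-zeroʳ (does (q ≤? t)) = refl

  layer-≥ : ∀ {t} c {p} → q ≤ t → h ≤ p → layer t c p ≡ next c
  layer-≥ {t} c {p} q≤t h≤p rewrite dec-true (q ≤? t) q≤t | dec-true (h ≤? p) h≤p = refl

  layer-suc : ∀ t c p → suc p ≢ h → layer t c p ≡ layer t c (suc p)
  layer-suc t c p 1+p≢h = cong (λ b → if does (q ≤? t) ∧ b then next c else c) (same (h ≤? p))
    where
    same : Dec (h ≤ p) → does (h ≤? p) ≡ does (h ≤? suc p)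
    same (yes h≤p) = trans (dec-true (h ≤? p) h≤p) (sym (dec-true (h ≤? suc p) (m≤n⇒m≤1+n h≤p)))
    same (no h≰p)  = trans (dec-false (h ≤? p) h≰p) (sym (dec-false (h ≤? suc p) (<⇒≱ (≤∧≢⇒< (≰⇒> h≰p) 1+p≢h))))

  layer⁻¹ : ℕ → Fin m → ℕ → Fin m
  layer⁻¹ t j p = if crosses t p then prev j else j

  layer-layer⁻¹ : ∀ t j p → layer t (layer⁻¹ t j p) p ≡ j
  layer-layer⁻¹ t j p with crosses t p
  ... | true  = next-prev j
  ... | false = refl

  layer-injective : ∀ t p {c c′} → layer t c p ≡ layer t c′ p → c ≡ c′
  layer-injective t p e with crosses t p
  ... | true  = next-injective e
  ... | false = e

  cycleVertex : Fin h → Fin m → Fin n → V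
  cycleVertex t c i = layer (toℕ t) c (toℕ i) , vertex (toℕ t) (toℕ i)

  toℕ-h<n : (t : Fin h) → toℕ t < n
  toℕ-h<n t = ≤-trans (toℕ<n t) h≤n

  cycleFactor : Fin h → CkFactor V n
  cycleFactor t = record { r = m ; cyc = cycleVertex t ; inj = injective ; surj = surjective }
    where
    injective : ∀ c i c′ i′ → cycleVertex t c i ≡ cycleVertex t c′ i′ → c ≡ c′ × i ≡ i′
    injective c i c′ i′ e with toℕ-injective (vertex-injective (toℕ t) (toℕ<n i) (toℕ<n i′) (cong proj₂ e))
    ... | refl = layer-injective (toℕ t) (toℕ i) (cong proj₁ e) , refl
    surjective : ∀ v → Σ (Fin m) λ c → Σ (Fin n) λ i → cycleVertex t c i ≡ v
    surjective (j , x) with vertex-surjective (toℕ-h<n t) x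
    ... | p , e = layer⁻¹ (toℕ t) j (toℕ p) , p , cong₂ _,_ (layer-layer⁻¹ (toℕ t) j (toℕ p)) e

  h′ : ℕ
  h′ = q′ + q

  h′<h : h′ < h
  h′<h = ≤-refl

  h<n : h < n
  h<n = m<m+n h (s≤s z≤n)

  ζ-h′ : ζ h′ ≡ q
  ζ-h′ = trans (cong ζ (+-suc q′ q′)) (ζ-odd q′)

  ζ-h : ζ h ≡ q + h
  ζ-h = trans (ζ-even q) (trans (cong (_∸ q) (+-assoc q q h)) (m+n∸m≡n q (q + h)))

  ζ-last : ζ (h′ + h) ≡ h
  ζ-last = trans (cong ζ (+-suc h′ h′)) (ζ-odd h′)

  first mid⁻ mid last : Fin n
  first = zero
  mid⁻  = fromℕ< (<-trans h′<h h<n)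
  mid   = fromℕ< h<n
  last  = fromℕ (h′ + h)

  vertex≡⊕ : ∀ t p → vertex t p ≡ [ t ] Zₙ.⊕ ζ p
  vertex≡⊕ t p = Zₙ.[]-cong (Zₙ.+-congʳ (ζ p) (Zₙ.≋-sym (Zₙ.toℕ-[]≋ t)))

  vertex-first : ∀ t → vertex t 0 ≡ [ t ]
  vertex-first t = trans (vertex≡⊕ t 0) (Zₙ.⊕-k [ t ])

  vertex-mid⁻ : ∀ t → vertex t h′ ≡ [ t ] Zₙ.⊕ q
  vertex-mid⁻ t = trans (vertex≡⊕ t h′) (cong ([ t ] Zₙ.⊕_) ζ-h′)

  vertex-mid : ∀ t → vertex t h ≡ flip ([ t ] Zₙ.⊕ q)
  vertex-mid t = trans (vertex≡⊕ t h) (trans (cong ([ t ] Zₙ.⊕_) ζ-h) (sym (Zₙ.⊕-assoc [ t ] q h)))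

  vertex-last : ∀ t → vertex t (h′ + h) ≡ flip [ t ]
  vertex-last t = trans (vertex≡⊕ t (h′ + h)) (cong ([ t ] Zₙ.⊕_) ζ-last)

  cycleVertex-at : ∀ t c {i p} → toℕ i ≡ p → cycleVertex t c i ≡ (layer (toℕ t) c p , vertex (toℕ t) p)
  cycleVertex-at t c refl = refl

  cycle-first : ∀ t c → cycleVertex t c first ≡ (c , [ toℕ t ])
  cycle-first t c = cong₂ _,_ (layer-<h (toℕ t) c (s≤s z≤n)) (vertex-first (toℕ t))

  cycle-mid⁻ : ∀ t c → cycleVertex t c mid⁻ ≡ (c , [ toℕ t ] Zₙ.⊕ q)
  cycle-mid⁻ t c = trans (cycleVertex-at t c {mid⁻} (toℕ-fromℕ< _)) (cong₂ _,_ (layer-<h (toℕ t) c h′<h) (vertex-mid⁻ (toℕ t)))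

  cycle-mid : ∀ t c → cycleVertex t c mid ≡ (layer (toℕ t) c h , flip ([ toℕ t ] Zₙ.⊕ q))
  cycle-mid t c = trans (cycleVertex-at t c {mid} (toℕ-fromℕ< h<n)) (cong (layer (toℕ t) c h ,_) (vertex-mid (toℕ t)))

  cycle-last : ∀ t c → cycleVertex t c last ≡ (layer (toℕ t) c (h′ + h) , flip [ toℕ t ])
  cycle-last t c = trans (cycleVertex-at t c {last} (toℕ-fromℕ (h′ + h))) (cong (layer (toℕ t) c (h′ + h) ,_) (vertex-last (toℕ t)))

  -- The 1-factor

  MatchedUp : Fin n → Set
  MatchedUp x = toℕ x < q ⊎ h + q ≤ toℕ x

  -- Opaque, so that `with matchedUp? x` also abstracts the occurrence inside μ.
  opaque
    matchedUp? : ∀ x → Dec (MatchedUp x)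
    matchedUp? x = toℕ x <? q ⊎-dec h + q ≤? toℕ x

  q≤h : q ≤ h
  q≤h = m≤m+n q q

  ¬MatchedUp : ∀ {x} → q ≤ toℕ x → toℕ x < h + q → ¬ MatchedUp x
  ¬MatchedUp q≤x x<h+q (inj₁ x<q)   = <⇒≱ x<q q≤x
  ¬MatchedUp q≤x x<h+q (inj₂ h+q≤x) = <⇒≱ x<h+q h+q≤x

  MatchedUp-flip : ∀ x → MatchedUp x → ¬ MatchedUp (flip x)
  MatchedUp-flip x (inj₁ x<q) = ¬MatchedUp {flip x}
    (subst (q ≤_) (sym fx≡x+h) (≤-trans q≤h (m≤n+m h (toℕ x))))
    (subst (_< h + q) (sym fx≡x+h) (subst (toℕ x + h <_) (+-comm q h) (+-monoˡ-< h x<q)))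
    where
    fx≡x+h : toℕ (flip x) ≡ toℕ x + h
    fx≡x+h = toℕ-flip-< x (<-≤-trans x<q q≤h)
  MatchedUp-flip x (inj₂ h+q≤x) = ¬MatchedUp {flip x} q≤fx fx<h+q
    where
    fx+h≡x : toℕ (flip x) + h ≡ toℕ x
    fx+h≡x = toℕ-flip-≥ x (≤-trans (m≤m+n h q) h+q≤x)
    q≤fx : q ≤ toℕ (flip x)
    q≤fx = +-cancelʳ-≤ h q (toℕ (flip x)) (subst₂ _≤_ (+-comm h q) (sym fx+h≡x) h+q≤x)
    fx<h+q : toℕ (flip x) < h + q
    fx<h+q = <-≤-trans (+-cancelʳ-< h (toℕ (flip x)) h (subst (_< n) (sym fx+h≡x) (toℕ<n x))) (m≤m+n h q)

  ¬MatchedUp-flip : ∀ x → ¬ MatchedUp x → MatchedUp (flip x)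
  ¬MatchedUp-flip x ¬up with toℕ x <? h
  ... | yes x<h = inj₂ (subst (h + q ≤_) (sym (toℕ-flip-< x x<h))
    (subst (_≤ toℕ x + h) (+-comm q h) (+-monoˡ-≤ h (≮⇒≥ (λ x<q → ¬up (inj₁ x<q))))))
  ... | no x≮h = inj₁ (+-cancelʳ-< h (toℕ (flip x)) q
    (subst₂ _<_ (sym (toℕ-flip-≥ x (≮⇒≥ x≮h))) (+-comm h q) (≰⇒> (λ h+q≤x → ¬up (inj₂ h+q≤x)))))

  μ : V → V
  μ (j , x) = (if does (matchedUp? x) then next j else prev j) , flip x

  μ-involutive : ∀ v → μ (μ v) ≡ v
  μ-involutive (j , x) with matchedUp? x | matchedUp? (flip x)
  ... | yes up | yes up′ = ⊥-elim (MatchedUp-flip x up up′)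
  ... | yes _  | no _    = cong₂ _,_ (prev-next j) (flip-flip x)
  ... | no _   | yes _   = cong₂ _,_ (next-prev j) (flip-flip x)
  ... | no ¬up | no ¬up′ = ⊥-elim (¬up′ (¬MatchedUp-flip x ¬up))

  μ-matchedUp : ∀ {j x} → MatchedUp x → μ (j , x) ≡ (next j , flip x)
  μ-matchedUp {j} {x} up with matchedUp? x
  ... | yes _  = refl
  ... | no ¬up = contradiction up ¬up

  matching : OneFactor V
  matching = record { μ = μ ; invol = μ-involutive ; nofix = λ v e → flip≢ (proj₂ v) (cong proj₂ e) }

  -- Each edge lies in at most one part

  E : Graph V
  E = CayAdj m n h ∪G mKnAdj m n

  E-sym : ∀ {u v} → E u v → E v u
  E-sym (inj₁ (j~j′ , y~x)) = inj₁ (swap j~j′ , AddMod-h-sym y~x)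
  E-sym (inj₂ (j≡j′ , x≢y)) = inj₂ (sym j≡j′ , λ y≡x → x≢y (sym y≡x))

  halfSum : Fin n → Fin n → ℕ
  halfSum x y = ⌊ (toℕ x + toℕ y) % n /2⌋

  diameterLabel : ℕ → ℕ
  diameterLabel s with q ≤? s
  ... | yes _ = s ∸ q
  ... | no _  = s

  diameterLabel-< : ∀ {s} → s < q → diameterLabel s ≡ s
  diameterLabel-< {s} s<q with q ≤? s
  ... | yes q≤s = contradiction q≤s (<⇒≱ s<q)
  ... | no _    = refl

  diameterLabel-≥ : ∀ {s} → q ≤ s → diameterLabel s ≡ s ∸ q
  diameterLabel-≥ {s} q≤s with q ≤? s
  ... | yes _   = refl
  ... | no q≰s  = contradiction q≤s q≰s

  pathLabel : Fin n → Fin n → ℕ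
  pathLabel x y with addMod? n h x y
  ... | yes _ = diameterLabel (halfSum x y)
  ... | no _  = halfSum x y

  pathLabel-sym : ∀ x y → pathLabel x y ≡ pathLabel y x
  pathLabel-sym x y with addMod? n h x y | addMod? n h y x
  ... | yes _   | yes _   = cong (λ z → diameterLabel ⌊ z % n /2⌋) (+-comm (toℕ x) (toℕ y))
  ... | no _    | no _    = cong (λ z → ⌊ z % n /2⌋) (+-comm (toℕ x) (toℕ y))
  ... | yes x~y | no ¬y~x = contradiction (AddMod-h-sym x~y) ¬y~x
  ... | no ¬x~y | yes y~x = contradiction (AddMod-h-sym y~x) ¬x~y

  pathLabel-diameter : ∀ x y → AddMod n h x y → pathLabel x y ≡ diameterLabel (halfSum x y)
  pathLabel-diameter x y x~y with addMod? n h x y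
  ... | yes _    = refl
  ... | no ¬x~y  = contradiction x~y ¬x~y

  crossLabel : Fin n → ℕ ⊎ ⊤
  crossLabel x with matchedUp? x | toℕ x <? h
  ... | yes _ | _     = inj₂ tt
  ... | no _  | yes _ = inj₁ (toℕ x)
  ... | no _  | no _  = inj₁ (toℕ x ∸ q)

  crossLabel-matched : ∀ {x} → MatchedUp x → crossLabel x ≡ inj₂ tt
  crossLabel-matched {x} up with matchedUp? x | toℕ x <? h
  ... | yes _  | _ = refl
  ... | no ¬up | _ = contradiction up ¬up

  crossLabel-<h : ∀ {x} → q ≤ toℕ x → toℕ x < h → crossLabel x ≡ inj₁ (toℕ x)
  crossLabel-<h {x} q≤x x<h with matchedUp? x | toℕ x <? h
  ... | yes up | _     = contradiction up (¬MatchedUp q≤x (<-≤-trans x<h (m≤m+n h q)))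
  ... | no _   | yes _ = refl
  ... | no _   | no x≮h = contradiction x<h x≮h

  crossLabel-≥h : ∀ {x} → h ≤ toℕ x → toℕ x < h + q → crossLabel x ≡ inj₁ (toℕ x ∸ q)
  crossLabel-≥h {x} h≤x x<h+q with matchedUp? x | toℕ x <? h
  ... | yes up | _      = contradiction up (¬MatchedUp (≤-trans q≤h h≤x) x<h+q)
  ... | no _   | yes x<h = contradiction h≤x (<⇒≱ x<h)
  ... | no _   | no _   = refl

  -- The part of an edge can be read off the edge: inside a layer it is half the sum of the
  -- endpoints (reduced modulo q on diameters), on a Cayley edge it is determined by the lower endpoint.
  label : V → V → ℕ ⊎ ⊤
  label (j , x) (j′ , y) with j ≟ᶠ j′
  ... | yes _ = inj₁ (pathLabel x y)
  ... | no _ with addMod? m 1 j j′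
  ...   | yes _ = crossLabel x
  ...   | no _  = crossLabel y

  label-same : ∀ j x y → label (j , x) (j , y) ≡ inj₁ (pathLabel x y)
  label-same j x y with j ≟ᶠ j
  ... | yes _  = refl
  ... | no j≢j = contradiction refl j≢j

  label-next : ∀ j x y → label (j , x) (next j , y) ≡ crossLabel x
  label-next j x y with j ≟ᶠ next j
  ... | yes j≡j′ = contradiction (sym j≡j′) (next≢ j)
  ... | no _ with addMod? m 1 j (next j)
  ...   | yes _   = refl
  ...   | no ¬j~j′ = contradiction (AddMod-next j) ¬j~j′

  label-prev : ∀ j x y → label (next j , y) (j , x) ≡ crossLabel x
  label-prev j x y with next j ≟ᶠ j
  ... | yes j′≡j = contradiction j′≡j (next≢ j)
  ... | no _ with addMod? m 1 (next j) j
  ...   | yes j′~j = contradiction j′~j (AddMod-asym (AddMod-next j))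
  ...   | no _     = refl

  LabelledEdge : ℕ ⊎ ⊤ → V → V → Set
  LabelledEdge ℓ u v = E u v × label u v ≡ ℓ × label v u ≡ ℓ

  LabelledEdge-sym : ∀ {ℓ u v} → LabelledEdge ℓ u v → LabelledEdge ℓ v u
  LabelledEdge-sym (uv , ℓuv , ℓvu) = E-sym uv , ℓvu , ℓuv

  LabelledEdge-resp : ∀ {ℓ ℓ′ u u′ v v′} → ℓ ≡ ℓ′ → u ≡ u′ → v ≡ v′ → LabelledEdge ℓ u v → LabelledEdge ℓ′ u′ v′
  LabelledEdge-resp refl refl refl e = e

  layer-edge : ∀ j x y → x ≢ y → LabelledEdge (inj₁ (pathLabel x y)) (j , x) (j , y)
  layer-edge j x y x≢y =
    inj₂ (refl , x≢y) , label-same j x y , trans (label-same j y x) (cong inj₁ (pathLabel-sym y x))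

  cayley-edge : ∀ j x → LabelledEdge (crossLabel x) (j , x) (next j , flip x)
  cayley-edge j x =
    inj₁ (inj₂ (AddMod-next j) , AddMod-h-sym (AddMod-flip x)) , label-next j x (flip x) , label-prev j x (flip x)

  matching-edge : ∀ u → LabelledEdge (inj₂ tt) u (μ u)
  matching-edge (j , x) with matchedUp? x
  ... | yes up = subst (λ ℓ → LabelledEdge ℓ (j , x) (next j , flip x)) (crossLabel-matched up) (cayley-edge j x)
  ... | no ¬up = LabelledEdge-sym (subst₂ (λ ℓ v → LabelledEdge ℓ (prev j , flip x) v)
    (crossLabel-matched (¬MatchedUp-flip x ¬up)) (cong₂ _,_ (next-prev j) (flip-flip x)) (cayley-edge (prev j) (flip x)))

  m+m+e<n : ∀ {t e} → t < h → e ≤ 1 → t + t + e < n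
  m+m+e<n {t} {e} t<h e≤1 = begin-strict
    t + t + e          ≤⟨ +-monoʳ-≤ (t + t) e≤1 ⟩
    t + t + 1          <⟨ n<1+n (t + t + 1) ⟩
    suc (t + t + 1)    ≡⟨ cong suc (trans (+-comm (t + t) 1) (sym (+-suc t t))) ⟩
    suc t + suc t      ≤⟨ +-mono-≤ t<h t<h ⟩
    n                  ∎
    where open ≤-Reasoning

  halfSum≡ : ∀ {x y t e} → t < h → e ≤ 1 → toℕ x + toℕ y ≋ t + t + e → halfSum x y ≡ t
  halfSum≡ {t = t} t<h e≤1 (Zₙ.mk≋ sum≡) =
    trans (cong ⌊_/2⌋ (trans sum≡ (m<n⇒m%n≡m (m+m+e<n t<h e≤1)))) (⌊m+m+e/2⌋≡m t e≤1)

  halfSum-along : ∀ {t} i → t < h → suc i < n → halfSum (vertex t i) (vertex t (suc i)) ≡ t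
  halfSum-along {t} i t<h 1+i<n with ζ-consecutive 1+i<n
  ... | e , e≤1 , sum≡ = halfSum≡ {vertex t i} {vertex t (suc i)} t<h e≤1 (begin
    toℕ (vertex t i) + toℕ (vertex t (suc i))  ≈⟨ Zₙ.+-cong (Zₙ.toℕ-[]≋ (t + ζ i)) (Zₙ.toℕ-[]≋ (t + ζ (suc i))) ⟩
    t + ζ i + (t + ζ (suc i))                  ≡⟨ interchange t (ζ i) t (ζ (suc i)) ⟩
    t + t + (ζ i + ζ (suc i))                  ≡⟨ cong (t + t +_) (trans sum≡ (+-comm n e)) ⟩
    t + t + (e + n)                            ≡⟨ +-assoc (t + t) e n ⟨
    t + t + e + n                              ≈⟨ Zₙ.m+k≋m (t + t + e) ⟩
    t + t + e                                  ∎)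
    where open Zₙ.≋-Reasoning

  ζ-step-not-diameter : ∀ i → suc i < n → suc i ≢ h → ¬ (ζ (suc i) ≋ ζ i + h)
  ζ-step-not-diameter i 1+i<n 1+i≢h step≋ with even⊎odd i
  ... | inj₁ (s , refl) = 1+m+m≢n+n s q (Zₙ.≋⇒≡ 1+i<n h<n (begin
    suc s + s          ≈⟨ Zₙ.+-congʳ s (Zₙ.≋-trans (Zₙ.≡⇒≋ (sym (ζ-odd s))) (Zₙ.≋-trans step≋ (Zₙ.≡⇒≋ (cong (_+ h) (ζ-even s))))) ⟩
    n ∸ s + h + s      ≡⟨ +-assoc (n ∸ s) h s ⟩
    n ∸ s + (h + s)    ≡⟨ cong (n ∸ s +_) (+-comm h s) ⟩
    n ∸ s + (s + h)    ≡⟨ +-assoc (n ∸ s) s h ⟨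
    n ∸ s + s + h      ≡⟨ cong (_+ h) (m∸n+n≡m (≤-trans (<⇒≤ (1+s+s<n⇒s<h s 1+i<n)) h≤n)) ⟩
    n + h              ≡⟨ +-comm n h ⟩
    h + n              ≈⟨ Zₙ.m+k≋m h ⟩
    h                  ∎))
    where open Zₙ.≋-Reasoning
  ... | inj₂ (s , refl) = 1+i≢h (trans 1+i≡2s′ (sym (Zₙ.≋⇒≡ h<n (subst (_< n) 1+i≡2s′ 1+i<n) h≋2s′)))
    where
    open Zₙ.≋-Reasoning
    s′ = suc s
    1+i≡2s′ : suc (suc (s + s)) ≡ s′ + s′
    1+i≡2s′ = cong suc (sym (+-suc s s))
    h≋2s′ : h ≋ s′ + s′
    h≋2s′ = Zₙ.+-cancelˡ h (s′ + s′) h (begin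
      h + h                ≡⟨ m∸n+n≡m (≤-trans (1+s+s<n⇒s<h s (<-trans (n<1+n _) 1+i<n)) h≤n) ⟨
      n ∸ s′ + s′          ≈⟨ Zₙ.+-congʳ s′ (Zₙ.≋-trans (Zₙ.≡⇒≋ (sym (trans (cong ζ 1+i≡2s′) (ζ-even s′))))
                                (Zₙ.≋-trans step≋ (Zₙ.≡⇒≋ (cong (_+ h) (ζ-odd s))))) ⟩
      s′ + h + s′          ≡⟨ +-assoc s′ h s′ ⟩
      s′ + (h + s′)        ≡⟨ cong (s′ +_) (+-comm h s′) ⟩
      s′ + (s′ + h)        ≡⟨ +-assoc s′ s′ h ⟨
      s′ + s′ + h          ≡⟨ +-comm (s′ + s′) h ⟩
      h + (s′ + s′)        ∎)

  vertex-step-not-diameter : ∀ t i → suc i < n → suc i ≢ h → ¬ AddMod n h (vertex t i) (vertex t (suc i))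
  vertex-step-not-diameter t i 1+i<n 1+i≢h d = ζ-step-not-diameter i 1+i<n 1+i≢h
    (Zₙ.+-cancelˡ (ζ (suc i)) (ζ i + h) t (begin
      t + ζ (suc i)             ≈⟨ Zₙ.toℕ-[]≋ (t + ζ (suc i)) ⟨
      toℕ (vertex t (suc i))    ≡⟨ cong toℕ (AddMod⇒≡flip {vertex t i} {vertex t (suc i)} d) ⟩
      toℕ (flip (vertex t i))   ≈⟨ Zₙ.toℕ-⊕≋ (vertex t i) h ⟩
      toℕ (vertex t i) + h      ≈⟨ Zₙ.+-congʳ h (Zₙ.toℕ-[]≋ (t + ζ i)) ⟩
      t + ζ i + h               ≡⟨ +-assoc t (ζ i) h ⟩
      t + (ζ i + h)             ∎))
    where open Zₙ.≋-Reasoning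

  pathLabel-along : ∀ {t} i → t < h → suc i < n → t < q ⊎ suc i ≢ h → pathLabel (vertex t i) (vertex t (suc i)) ≡ t
  pathLabel-along {t} i t<h 1+i<n cond with addMod? n h (vertex t i) (vertex t (suc i)) | cond
  ... | no _  | _          = halfSum-along i t<h 1+i<n
  ... | yes _ | inj₁ t<q   = trans (cong diameterLabel (halfSum-along i t<h 1+i<n)) (diameterLabel-< t<q)
  ... | yes d | inj₂ 1+i≢h = contradiction d (vertex-step-not-diameter t i 1+i<n 1+i≢h)

  pathLabel-closing : ∀ {t} → t < q → pathLabel (flip [ t ]) [ t ] ≡ t
  pathLabel-closing {t} t<q = begin
    pathLabel (flip [ t ]) [ t ]                ≡⟨ pathLabel-diameter (flip [ t ]) [ t ] (AddMod-h-sym (AddMod-flip [ t ])) ⟩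
    diameterLabel (halfSum (flip [ t ]) [ t ])  ≡⟨ cong diameterLabel (halfSum≡ {flip [ t ]} {[ t ]} (+-monoˡ-< q t<q) z≤n sum≋) ⟩
    diameterLabel (t + q)                       ≡⟨ diameterLabel-≥ (m≤n+m q t) ⟩
    t + q ∸ q                                   ≡⟨ m+n∸n≡m t q ⟩
    t                                           ∎
    where
    open ≡-Reasoning
    sum≋ : toℕ (flip [ t ]) + toℕ [ t ] ≋ t + q + (t + q) + 0
    sum≋ = Zₙ.≋-trans (Zₙ.+-cong (Zₙ.≋-trans (Zₙ.toℕ-⊕≋ [ t ] h) (Zₙ.+-congʳ h (Zₙ.toℕ-[]≋ t))) (Zₙ.toℕ-[]≋ t))
      (Zₙ.≡⇒≋ (begin
        t + h + t              ≡⟨ +-comm (t + h) t ⟩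
        t + (t + h)            ≡⟨ +-assoc t t h ⟨
        t + t + h              ≡⟨ interchange t q t q ⟨
        t + q + (t + q)        ≡⟨ +-identityʳ _ ⟨
        t + q + (t + q) + 0    ∎))

  crossLabel-middle : ∀ {t} → q ≤ t → t < h → crossLabel ([ t ] Zₙ.⊕ q) ≡ inj₁ t
  crossLabel-middle {t} q≤t t<h =
    trans (crossLabel-≥h (subst (h ≤_) (sym x≡t+q) (+-monoˡ-≤ q q≤t)) (subst (_< h + q) (sym x≡t+q) (+-monoˡ-< q t<h)))
          (cong inj₁ (trans (cong (_∸ q) x≡t+q) (m+n∸n≡m t q)))
    where
    x≡t+q : toℕ ([ t ] Zₙ.⊕ q) ≡ t + q
    x≡t+q = trans (Zₙ.toℕ-[]-< (subst (λ z → z + q < n) (sym (Zₙ.toℕ-[]-< (<-≤-trans t<h h≤n))) t+q<n))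
                  (cong (_+ q) (Zₙ.toℕ-[]-< (<-≤-trans t<h h≤n)))
      where
      t+q<n : t + q < n
      t+q<n = <-≤-trans (+-monoˡ-< q t<h) (+-monoʳ-≤ h q≤h)

  crossLabel-wrap : ∀ {t} → q ≤ t → t < h → crossLabel [ t ] ≡ inj₁ t
  crossLabel-wrap {t} q≤t t<h =
    trans (crossLabel-<h (subst (q ≤_) (sym [t]≡t) q≤t) (subst (_< h) (sym [t]≡t) t<h)) (cong inj₁ [t]≡t)
    where
    [t]≡t : toℕ [ t ] ≡ t
    [t]≡t = Zₙ.toℕ-[]-< (<-≤-trans t<h h≤n)

  data Step (t : Fin h) : Fin n → Fin n → Set where
    along  : ∀ {i i′} → toℕ i′ ≡ suc (toℕ i) → toℕ t < q ⊎ toℕ i′ ≢ h → Step t i i′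
    middle : q ≤ toℕ t → Step t mid⁻ mid
    wrap   : Step t last first

  step : ∀ t {i i′} → AddMod n 1 i i′ → Step t i i′
  step t {i} {i′} (inj₁ i′≡i+1) = along-or-middle (toℕ i′ ≟ h) (q ≤? toℕ t)
    where
    i′≡1+i : toℕ i′ ≡ suc (toℕ i)
    i′≡1+i = trans i′≡i+1 (+-comm (toℕ i) 1)
    along-or-middle : Dec (toℕ i′ ≡ h) → Dec (q ≤ toℕ t) → Step t i i′
    along-or-middle (no i′≢h) _        = along i′≡1+i (inj₂ i′≢h)
    along-or-middle (yes _)   (no q≰t) = along i′≡1+i (inj₁ (≰⇒> q≰t))
    along-or-middle (yes i′≡h) (yes q≤t) = subst₂ (Step t) (sym i≡mid⁻) (sym i′≡mid) (middle q≤t)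
      where
      i′≡mid : i′ ≡ mid
      i′≡mid = toℕ-injective (trans i′≡h (sym (toℕ-fromℕ< h<n)))
      i≡mid⁻ : i ≡ mid⁻
      i≡mid⁻ = toℕ-injective (trans (suc-injective (trans (sym i′≡1+i) i′≡h)) (sym (toℕ-fromℕ< _)))
  step t {i} {i′} (inj₂ i′+n≡i+1) = subst₂ (Step t) (sym i≡last) (sym i′≡first) wrap
    where
    i′≡0 : toℕ i′ ≡ 0
    i′≡0 = n≤0⇒n≡0 (+-cancelʳ-≤ n (toℕ i′) 0 (≤-trans (≤-reflexive i′+n≡i+1) (subst (_≤ n) (+-comm 1 (toℕ i)) (toℕ<n i))))
    i′≡first : i′ ≡ first
    i′≡first = toℕ-injective i′≡0
    i≡last : i ≡ last
    i≡last = toℕ-injective (trans (suc-injective (trans (+-comm 1 (toℕ i)) (trans (sym i′+n≡i+1) (cong (_+ n) i′≡0))))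
                                  (sym (toℕ-fromℕ (h′ + h))))

  cycle-edge : ∀ t c {i i′} → Step t i i′ → LabelledEdge (inj₁ (toℕ t)) (cycleVertex t c i) (cycleVertex t c i′)
  cycle-edge t c {i} {i′} (along i′≡1+i cond) =
    LabelledEdge-resp (cong inj₁ pathLabel≡t) (cong (_, vertex T (toℕ i)) (sym (same-layer cond))) refl
      (layer-edge (layer T c (toℕ i′)) (vertex T (toℕ i)) (vertex T (toℕ i′)) distinct)
    where
    T = toℕ t
    same-layer : toℕ t < q ⊎ toℕ i′ ≢ h → layer T c (toℕ i) ≡ layer T c (toℕ i′)
    same-layer (inj₁ t<q)  = trans (layer-<q c (toℕ i) t<q) (sym (layer-<q c (toℕ i′) t<q))
    same-layer (inj₂ i′≢h) = trans (layer-suc T c (toℕ i) (λ 1+i≡h → i′≢h (trans i′≡1+i 1+i≡h))) (cong (layer T c) (sym i′≡1+i))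
    distinct : vertex T (toℕ i) ≢ vertex T (toℕ i′)
    distinct e = 1+n≢n (sym (trans (vertex-injective T (toℕ<n i) (toℕ<n i′) e) i′≡1+i))
    pathLabel≡t : pathLabel (vertex T (toℕ i)) (vertex T (toℕ i′)) ≡ T
    pathLabel≡t = trans (cong (λ p → pathLabel (vertex T (toℕ i)) (vertex T p)) i′≡1+i)
      (pathLabel-along (toℕ i) (toℕ<n t) (subst (_< n) i′≡1+i (toℕ<n i′))
        (map₂ (λ i′≢h 1+i≡h → i′≢h (trans i′≡1+i 1+i≡h)) cond))
  cycle-edge t c (middle q≤t) =
    LabelledEdge-resp (crossLabel-middle q≤t (toℕ<n t)) (sym (cycle-mid⁻ t c))
      (sym (trans (cycle-mid t c) (cong (_, _) (layer-≥ c q≤t ≤-refl))))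
      (cayley-edge c ([ toℕ t ] Zₙ.⊕ q))
  cycle-edge t c wrap with q ≤? toℕ t
  ... | yes q≤t = LabelledEdge-resp (crossLabel-wrap q≤t (toℕ<n t))
      (sym (trans (cycle-last t c) (cong (_, _) (layer-≥ c q≤t (m≤n+m h h′))))) (sym (cycle-first t c))
      (LabelledEdge-sym (cayley-edge c [ toℕ t ]))
  ... | no q≰t = LabelledEdge-resp (cong inj₁ (pathLabel-closing (≰⇒> q≰t)))
      (sym (trans (cycle-last t c) (cong (_, _) (layer-<q c (h′ + h) (≰⇒> q≰t))))) (sym (cycle-first t c))
      (layer-edge c (flip [ toℕ t ]) [ toℕ t ] (flip≢ [ toℕ t ]))

  Part : Set
  Part = Fin h ⊎ ⊤

  part : Part → Graph V
  part = PartEdge cycleFactor matching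

  code : Part → ℕ ⊎ ⊤
  code = map₁ toℕ

  code-injective : ∀ {p p′} → code p ≡ code p′ → p ≡ p′
  code-injective {inj₁ _}  {inj₁ _}  e = cong inj₁ (toℕ-injective (inj₁-injective e))
  code-injective {inj₂ tt} {inj₂ tt} _ = refl
  code-injective {inj₁ _}  {inj₂ _}  ()
  code-injective {inj₂ _}  {inj₁ _}  ()

  part-labelled : ∀ p u v → part p u v → LabelledEdge (code p) u v
  part-labelled (inj₁ t) _ _ (c , i , i′ , i~i′ , inj₁ (refl , refl)) = cycle-edge t c (step t i~i′)
  part-labelled (inj₁ t) _ _ (c , i , i′ , i~i′ , inj₂ (refl , refl)) = LabelledEdge-sym (cycle-edge t c (step t i~i′))
  part-labelled (inj₂ tt) u _ refl = matching-edge u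

  -- Each edge lies in some part

  Covered : V → V → Set
  Covered u v = Σ Part λ p → part p u v

  Covered-sym : ∀ {u v} → Covered u v → Covered v u
  Covered-sym (inj₁ t , c , i , i′ , i~i′ , uv) = inj₁ t , c , i , i′ , i~i′ , swap uv
  Covered-sym {u} (inj₂ tt , v≡μu) = inj₂ tt , sym (trans (cong μ v≡μu) (μ-involutive u))

  mid⁻~mid : AddMod n 1 mid⁻ mid
  mid⁻~mid = inj₁ (trans (toℕ-fromℕ< h<n) (trans (+-comm 1 h′) (cong (_+ 1) (sym (toℕ-fromℕ< _)))))

  last~first : AddMod n 1 last first
  last~first = inj₂ (trans (+-comm 1 (h′ + h)) (cong (_+ 1) (sym (toℕ-fromℕ (h′ + h)))))

  [toℕ]≡ : ∀ {t : Fin h} {x : Fin n} → toℕ t ≡ toℕ x → [ toℕ t ] ≡ x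
  [toℕ]≡ {x = x} t≡x = trans (cong [_] t≡x) (Zₙ.[]-toℕ x)

  cover-cayley : ∀ j x → Covered (j , x) (next j , flip x)
  cover-cayley j x with matchedUp? x
  ... | yes up = inj₂ tt , sym (μ-matchedUp {j} up)
  ... | no ¬up with toℕ x <? h
  ...   | yes x<h = inj₁ t , j , last , first , last~first , inj₂
            ( trans (cycle-last t j) (cong₂ _,_ (layer-≥ j q≤t (m≤n+m h h′)) (cong flip [t]≡x))
            , trans (cycle-first t j) (cong (j ,_) [t]≡x))
    where
    t = fromℕ< x<h
    [t]≡x : [ toℕ t ] ≡ x
    [t]≡x = [toℕ]≡ (toℕ-fromℕ< x<h)
    q≤t : q ≤ toℕ t
    q≤t = subst (q ≤_) (sym (toℕ-fromℕ< x<h)) (≮⇒≥ (λ x<q → ¬up (inj₁ x<q)))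
  ...   | no x≮h = inj₁ t , j , mid⁻ , mid , mid⁻~mid , inj₁
            ( trans (cycle-mid⁻ t j) (cong (j ,_) [t]⊕q≡x)
            , trans (cycle-mid t j) (cong₂ _,_ (layer-≥ j q≤t ≤-refl) (cong flip [t]⊕q≡x)))
    where
    q≤x : q ≤ toℕ x
    q≤x = ≤-trans q≤h (≮⇒≥ x≮h)
    x∸q<h : toℕ x ∸ q < h
    x∸q<h = +-cancelʳ-< q (toℕ x ∸ q) h (subst (_< h + q) (sym (m∸n+n≡m q≤x)) (≰⇒> (λ h+q≤x → ¬up (inj₂ h+q≤x))))
    t = fromℕ< x∸q<h
    [t]⊕q≡x : [ toℕ t ] Zₙ.⊕ q ≡ x
    [t]⊕q≡x = Zₙ.[]-⊕ (toℕ t) q x (trans (cong (_+ q) (toℕ-fromℕ< x∸q<h)) (m∸n+n≡m q≤x))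
    q≤t : q ≤ toℕ t
    q≤t = subst (q ≤_) (sym (toℕ-fromℕ< x∸q<h))
      (+-cancelʳ-≤ q q (toℕ x ∸ q) (subst (h ≤_) (sym (m∸n+n≡m q≤x)) (≮⇒≥ x≮h)))

  cover-diameter-low : ∀ j x → toℕ x < h → Covered (j , x) (j , flip x)
  cover-diameter-low j x x<h with toℕ x <? q
  ... | yes x<q = inj₁ t , j , last , first , last~first , inj₂
          ( trans (cycle-last t j) (cong₂ _,_ (layer-<q j (h′ + h) t<q) (cong flip [t]≡x))
          , trans (cycle-first t j) (cong (j ,_) [t]≡x))
    where
    t = fromℕ< x<h
    [t]≡x : [ toℕ t ] ≡ x
    [t]≡x = [toℕ]≡ (toℕ-fromℕ< x<h)
    t<q : toℕ t < q
    t<q = subst (_< q) (sym (toℕ-fromℕ< x<h)) x<q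
  ... | no x≮q = inj₁ t , j , mid⁻ , mid , mid⁻~mid , inj₁
          ( trans (cycle-mid⁻ t j) (cong (j ,_) [t]⊕q≡x)
          , trans (cycle-mid t j) (cong₂ _,_ (layer-<q j h t<q) (cong flip [t]⊕q≡x)))
    where
    q≤x : q ≤ toℕ x
    q≤x = ≮⇒≥ x≮q
    x∸q<q : toℕ x ∸ q < q
    x∸q<q = +-cancelʳ-< q (toℕ x ∸ q) q (subst (_< h) (sym (m∸n+n≡m q≤x)) x<h)
    t = fromℕ< (<-≤-trans x∸q<q q≤h)
    [t]⊕q≡x : [ toℕ t ] Zₙ.⊕ q ≡ x
    [t]⊕q≡x = Zₙ.[]-⊕ (toℕ t) q x (trans (cong (_+ q) (toℕ-fromℕ< _)) (m∸n+n≡m q≤x))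
    t<q : toℕ t < q
    t<q = subst (_< q) (sym (toℕ-fromℕ< _)) x∸q<q

  cover-diameter : ∀ j x y → AddMod n h x y → Covered (j , x) (j , y)
  cover-diameter j x y x~y with toℕ x <? h
  ... | yes x<h = subst (λ z → Covered (j , x) (j , z)) (sym (AddMod⇒≡flip {x} {y} x~y)) (cover-diameter-low j x x<h)
  ... | no x≮h = Covered-sym (subst (λ z → Covered (j , y) (j , z)) (sym x≡flip-y) (cover-diameter-low j y y<h))
    where
    x≡flip-y : x ≡ flip y
    x≡flip-y = AddMod⇒≡flip {y} {x} (AddMod-h-sym x~y)
    y+h≡x : toℕ y + h ≡ toℕ x
    y+h≡x = trans (cong (λ z → toℕ z + h) (AddMod⇒≡flip {x} {y} x~y)) (toℕ-flip-≥ x (≮⇒≥ x≮h))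
    y<h : toℕ y < h
    y<h = +-cancelʳ-< h (toℕ y) h (subst (_< n) (sym y+h≡x) (toℕ<n x))

  along-part : ∀ t j {a b} (pa pb : Fin n) → vertex (toℕ t) (toℕ pa) ≡ a → vertex (toℕ t) (toℕ pb) ≡ b →
               toℕ pb ≡ suc (toℕ pa) → ¬ AddMod n h a b → part (inj₁ t) (j , a) (j , b)
  along-part t j pa pb pa↦a pb↦b pb≡1+pa ¬a~b =
    c , pa , pb , inj₁ (trans pb≡1+pa (+-comm 1 (toℕ pa))) , inj₁
      ( cong₂ _,_ (layer-layer⁻¹ T j (toℕ pa)) pa↦a
      , cong₂ _,_ (trans (sym same-layer) (layer-layer⁻¹ T j (toℕ pa))) pb↦b)
    where
    T = toℕ t
    c = layer⁻¹ T j (toℕ pa)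
    pb≢h : toℕ pb ≢ h
    pb≢h pb≡h = ¬a~b (subst₂ (AddMod n h)
      (trans (sym (vertex-mid⁻ T)) (trans (cong (vertex T) (sym (suc-injective (trans (sym pb≡1+pa) pb≡h)))) pa↦a))
      (trans (sym (vertex-mid T)) (trans (cong (vertex T) (sym pb≡h)) pb↦b))
      (AddMod-flip ([ T ] Zₙ.⊕ q)))
    same-layer : layer T c (toℕ pa) ≡ layer T c (toℕ pb)
    same-layer = trans (layer-suc T c (toℕ pa) (λ 1+pa≡h → pb≢h (trans pb≡1+pa 1+pa≡h))) (cong (layer T c) (sym pb≡1+pa))

  ζ-sum≋ : ∀ {t e x y} pa pb → vertex t pa ≡ x → vertex t pb ≡ y → toℕ x + toℕ y ≋ t + t + e → ζ pa + ζ pb ≋ e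
  ζ-sum≋ {t} {e} {x} {y} pa pb pa↦x pb↦y sum≋ = Zₙ.+-cancelˡ (ζ pa + ζ pb) e (t + t) (begin
    t + t + (ζ pa + ζ pb)       ≡⟨ interchange t (ζ pa) t (ζ pb) ⟨
    t + ζ pa + (t + ζ pb)       ≈⟨ Zₙ.+-cong (Zₙ.≋-trans (Zₙ.≋-sym (Zₙ.toℕ-[]≋ (t + ζ pa))) (Zₙ.≡⇒≋ (cong toℕ pa↦x)))
                                             (Zₙ.≋-trans (Zₙ.≋-sym (Zₙ.toℕ-[]≋ (t + ζ pb))) (Zₙ.≡⇒≋ (cong toℕ pb↦y))) ⟩
    toℕ x + toℕ y               ≈⟨ sum≋ ⟩
    t + t + e                   ∎)
    where open Zₙ.≋-Reasoning

  1<n : 1 < n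
  1<n = s≤s (≤-trans (s≤s z≤n) (m≤n+m h h′))

  chord-on-path : ∀ j x y → x ≢ y → ¬ AddMod n h x y → ∀ t {e} → e ≤ 1 →
                  toℕ x + toℕ y ≋ toℕ t + toℕ t + e → Covered (j , x) (j , y)
  chord-on-path j x y x≢y ¬x~y t {e} e≤1 sum≋
    with vertex-surjective (toℕ-h<n t) x | vertex-surjective (toℕ-h<n t) y
  ... | pa , pa↦x | pb , pb↦y = adjacent-or-equal (Zₙ.≋-above (≤-<-trans e≤1 1<n) e<A+B A+B≤2n
                                  (ζ-sum≋ {toℕ t} (toℕ pa) (toℕ pb) pa↦x pb↦y sum≋))
    where
    T = toℕ t
    A = ζ (toℕ pa)
    B = ζ (toℕ pb)
    rangeA = ζ-range (toℕ<n pa)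
    rangeB = ζ-range (toℕ<n pb)
    e<A+B : e < A + B
    e<A+B = ≤-trans (s≤s e≤1) (+-mono-≤ (proj₁ rangeA) (proj₁ rangeB))
    A+B≤2n : A + B ≤ n + n
    A+B≤2n = +-mono-≤ (proj₂ rangeA) (proj₂ rangeB)
    pa≢pb : toℕ pa ≢ toℕ pb
    pa≢pb pa≡pb = x≢y (trans (sym pa↦x) (trans (cong (vertex T) pa≡pb) pb↦y))
    adjacent-or-equal : A + B ≡ n + e ⊎ A + B ≡ n + n → Covered (j , x) (j , y)
    adjacent-or-equal (inj₂ A+B≡2n) = contradiction (ζ-injective (toℕ<n pa) (toℕ<n pb) (trans A≡n (sym B≡n))) pa≢pb
      where
      A≡n : A ≡ n
      A≡n = m+n≡o+o⇒m≡o (proj₂ rangeA) (proj₂ rangeB) A+B≡2n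
      B≡n : B ≡ n
      B≡n = m+n≡o+o⇒m≡o (proj₂ rangeB) (proj₂ rangeA) (trans (+-comm B A) A+B≡2n)
    adjacent-or-equal (inj₁ A+B≡n+e) with ζ-sum⇒adjacent (toℕ<n pa) (toℕ<n pb) pa≢pb e≤1 A+B≡n+e
    ... | inj₁ pb≡1+pa = inj₁ t , along-part t j pa pb pa↦x pb↦y pb≡1+pa ¬x~y
    ... | inj₂ pa≡1+pb = Covered-sym (inj₁ t , along-part t j pb pa pb↦y pa↦x pa≡1+pb (λ y~x → ¬x~y (AddMod-h-sym y~x)))

  cover-chord : ∀ j x y → x ≢ y → ¬ AddMod n h x y → Covered (j , x) (j , y)
  cover-chord j x y x≢y ¬x~y = by-parity (even⊎odd σ)
    where
    σ = (toℕ x + toℕ y) % n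
    on-path : ∀ s e → e ≤ 1 → σ ≡ s + s + e → Covered (j , x) (j , y)
    on-path s e e≤1 σ≡ = chord-on-path j x y x≢y ¬x~y (fromℕ< s<h) e≤1
      (Zₙ.≋-trans (Zₙ.≋-sym (Zₙ.m%k≋m _)) (Zₙ.≡⇒≋ (trans σ≡ (cong (λ z → z + z + e) (sym (toℕ-fromℕ< s<h))))))
      where
      s<h : s < h
      s<h = s+s<n⇒s<h s (≤-<-trans (m≤m+n (s + s) e) (subst (_< n) σ≡ (m%n<n (toℕ x + toℕ y) n)))
    by-parity : (∃ λ s → σ ≡ s + s) ⊎ (∃ λ s → σ ≡ suc (s + s)) → Covered (j , x) (j , y)
    by-parity (inj₁ (s , σ≡)) = on-path s 0 z≤n (trans σ≡ (sym (+-identityʳ (s + s))))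
    by-parity (inj₂ (s , σ≡)) = on-path s 1 (s≤s z≤n) (trans σ≡ (+-comm 1 (s + s)))

  cover : ∀ u v → E u v → Covered u v
  cover (j , x) (j′ , y) (inj₁ (inj₂ j~j′ , y~x)) =
    subst (Covered (j , x)) (sym (cong₂ _,_ (AddMod⇒≡next {j} {j′} j~j′) (AddMod⇒≡flip {x} {y} (AddMod-h-sym y~x))))
      (cover-cayley j x)
  cover (j , x) (j′ , y) (inj₁ (inj₁ j′~j , y~x)) = Covered-sym
    (subst (Covered (j′ , y)) (sym (cong₂ _,_ (AddMod⇒≡next {j′} {j} j′~j) (AddMod⇒≡flip {y} {x} y~x)))
      (cover-cayley j′ y))
  cover (j , x) (_ , y) (inj₂ (refl , x≢y)) with addMod? n h x y
  ... | yes x~y  = cover-diameter j x y x~y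
  ... | no ¬x~y = cover-chord j x y x≢y ¬x~y

  decomposition : DecomposesInto E h n
  decomposition = cycleFactor , matching , cover , sound , unique
    where
    sound : ∀ p u v → part p u v → E u v
    sound p u v uv = proj₁ (part-labelled p u v uv)
    unique : ∀ p p′ u v → part p u v → part p′ u v → p ≡ p′
    unique p p′ u v uv uv′ =
      code-injective (trans (sym (proj₁ (proj₂ (part-labelled p u v uv)))) (proj₁ (proj₂ (part-labelled p′ u v uv′))))

lemma2p8 : (m l : ℕ) → 3 ≤ m → 3 ≤ l →
    DecomposesInto (G m l) (2 ^ (l ∸ 1)) (2 ^ l)
lemma2p8 (suc (suc (suc m′))) (suc (suc (suc k))) (s≤s (s≤s (s≤s _))) (s≤s (s≤s (s≤s _))) =
  subst₂ (λ N H → DecomposesInto (CayAdj m N H ∪G mKnAdj m N) H N) n≡2^l h≡2^[l∸1] decomposition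
  where
  open Decomposition m′ (pred (2 ^ suc k))
  q≡2^[l∸2] : q ≡ 2 ^ suc k
  q≡2^[l∸2] = suc-pred (2 ^ suc k) {{m^n≢0 2 (suc k)}}
  h≡2^[l∸1] : h ≡ 2 ^ suc (suc k)
  h≡2^[l∸1] = trans (cong (λ z → z + z) q≡2^[l∸2]) (cong (2 ^ suc k +_) (sym (+-identityʳ (2 ^ suc k))))
  n≡2^l : n ≡ 2 ^ suc (suc (suc k))
  n≡2^l = trans (cong (λ z → z + z) h≡2^[l∸1]) (cong (2 ^ suc (suc k) +_) (sym (+-identityʳ (2 ^ suc (suc k)))))
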